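{- Let $G$ be a $k$-regular graph on $n$ vertices, and let $L(G)$ be its line graph. Then $mo(L(G))\ge \dfrac{n(k-1)}{4}$.
   Context: The line graph $L(G)$ has the edges of $G$ as vertices, two being adjacent iff they share an endpoint. For a graph with threshold assignment $\tau$, a set $M$ of vertices is a $\tau$-monopoly if every vertex $v\notin M$ has at least $\tau(v)$ neighbors in $M$. $mo(L(G))$ denotes the minimum size of a $\tau$-monopoly of $L(G)$ for the simple majority threshold $\tau(v)=d_{L(G)}(v)/2$; for $G$ $k$-regular this is $\tau(v)=k-1$ for every vertex $v$ of $L(G)$. -}

module Defs where

open import Data.Bool using (Bool; true; false; _∧_; _∨_; not)
open import Data.Nat using (ℕ; _*_; _≤_; _<ᵇ_)
open import Data.Fin using (Fin; toℕ; _≟_)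
open import Data.Fin.Subset using (Subset; _∈_; _∉_; _∩_; ∣_∣)
open import Data.List using (List; length; lookup; map; concatMap; allFin; filterᵇ)
open import Data.Vec using (tabulate)
open import Data.Product using (_×_; _,_)
open import Relation.Nullary.Decidable using (⌊_⌋)
open import Relation.Binary.PropositionalEquality using (_≡_)

Graph : ℕ → Set
Graph n = Fin n → Fin n → Bool

record IsSimple {n : ℕ} (G : Graph n) : Set where
  field
    sym    : ∀ i j → G i j ≡ G j i
    irrefl : ∀ i → G i i ≡ false

nbhd : {n : ℕ} → Graph n → Fin n → Subset n
nbhd G i = tabulate (G i)

deg : {n : ℕ} → Graph n → Fin n → ℕ
deg G i = ∣ nbhd G i ∣

Regular : {n : ℕ} → Graph n → ℕ → Set
Regular G k = ∀ i → deg G i ≡ k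

allPairs : (n : ℕ) → List (Fin n × Fin n)
allPairs n = concatMap (λ i → map (λ j → (i , j)) (allFin n)) (allFin n)

edgeList : {n : ℕ} → Graph n → List (Fin n × Fin n)
edgeList {n} G = filterᵇ (λ { (i , j) → (toℕ i <ᵇ toℕ j) ∧ G i j }) (allPairs n)

numEdges : {n : ℕ} → Graph n → ℕ
numEdges G = length (edgeList G)

edge : {n : ℕ} (G : Graph n) → Fin (numEdges G) → Fin n × Fin n
edge G e = lookup (edgeList G) e

shareEnd : {n : ℕ} → Fin n × Fin n → Fin n × Fin n → Bool
shareEnd (a , b) (c , d) = ⌊ a ≟ c ⌋ ∨ ⌊ a ≟ d ⌋ ∨ ⌊ b ≟ c ⌋ ∨ ⌊ b ≟ d ⌋

LineGraph : {n : ℕ} (G : Graph n) → Graph (numEdges G)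
LineGraph G e f = not ⌊ e ≟ f ⌋ ∧ shareEnd (edge G e) (edge G f)

-- τ-monopoly for the simple majority threshold τ(v) = deg(v)/2:
-- every vertex v ∉ M has at least deg(v)/2 neighbours in M,
-- i.e. deg(v) ≤ 2 · |N(v) ∩ M|.
IsMajorityMonopoly : {m : ℕ} → Graph m → Subset m → Set
IsMajorityMonopoly H M = ∀ v → v ∉ M → deg H v ≤ 2 * ∣ nbhd H v ∩ M ∣

-- Write m(x) and c(x) for the numbers of edges at x inside and outside M, so that
-- m(x) + c(x) = k.  An edge uv ∉ M has 2k − 2 neighbours in L(G), and its neighbours in M
-- are among the m(u) + m(v) edges of M at u or v, so the majority condition gives
-- m(u) + m(v) ≥ k − 1, that is c(u) + c(v) ≤ k + 1.  Summing over the h edges outside M,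
-- Σₓ c(x)² = Σ_{uv ∉ M} (c(u) + c(v)) ≤ h(k + 1), while Σₓ c(x) = 2h; Cauchy–Schwarz then
-- gives 4h ≤ n(k + 1), and with 2|M| + 2h = nk this is 4|M| ≥ n(k − 1).

module Submission where

open import Defs
open import Data.Bool using (Bool; true; false; not; _∧_; _∨_; T)
open import Data.Bool.Properties using (T-≡; T-∧)
open import Data.Empty using (⊥-elim)
open import Data.Fin as Fin using (Fin; toℕ; _≟_)
open import Data.Fin.Properties using (toℕ-injective)
open import Data.Fin.Subset using (Subset; ∣_∣; _∉_; _∩_; ∁)
open import Data.Fin.Subset.Properties using (x∈∁p⇒x∉p)
open import Data.List as List using (List; []; _∷_; length; map; concatMap; filterᵇ; allFin)
open import Data.List.Membership.Propositional.Properties using (∈-filter⁻; ∈-lookup)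
open import Data.List.Properties using (map-++; map-∘)
open import Data.Nat using (ℕ; zero; suc; _+_; _*_; _∸_; _≤_; _<_; _<ᵇ_; z≤n; s≤s)
import Data.Nat.ListAction as ℕList
open import Data.Nat.ListAction.Properties using (sum-++)
open import Data.Nat.Properties hiding (_≟_)
open import Algebra.Properties.CommutativeSemigroup *-commutativeSemigroup using (x∙yz≈y∙xz)
open import Algebra.Properties.Semiring.Sum +-*-semiring
open import Data.Nat.Tactic.RingSolver using (solve-∀)
open import Data.Product using (_×_; _,_; proj₁; proj₂)
open import Data.Sum using ([_,_]′)
import Data.Vec as Vec
open import Data.Vec.Properties using (lookup∘tabulate; lookup-zipWith; lookup-map; lookup⇒[]=)
open import Function using (_∘_; Equivalence)
open import Relation.Binary.PropositionalEquality
open import Relation.Nullary using (Dec; yes; no)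
open import Relation.Nullary.Decidable using (⌊_⌋; T?)

∑-mono-≤ : ∀ {n} {f g : Fin n → ℕ} → (∀ i → f i ≤ g i) → ∑[ i < n ] f i ≤ ∑[ i < n ] g i
∑-mono-≤ {zero}  f≤g = z≤n
∑-mono-≤ {suc n} f≤g = +-mono-≤ (f≤g Fin.zero) (∑-mono-≤ (f≤g ∘ Fin.suc))

∑-const : ∀ n c → ∑[ i < n ] c ≡ n * c
∑-const zero    c = refl
∑-const (suc n) c = cong (c +_) (∑-const n c)

∑-*-∑ : ∀ {m n} (f : Fin m → ℕ) (g : Fin n → ℕ) → sum f * sum g ≡ ∑[ i < m ] ∑[ j < n ] (f i * g j)
∑-*-∑ f g = trans (*-distribʳ-sum (sum g) f) (sum-cong-≗ (λ i → *-distribˡ-sum (f i) g))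

∑∑-distrib-+ : ∀ {m n} (f g : Fin m → Fin n → ℕ) →
               ∑[ i < m ] ∑[ j < n ] (f i j + g i j) ≡ ∑[ i < m ] ∑[ j < n ] f i j + ∑[ i < m ] ∑[ j < n ] g i j
∑∑-distrib-+ {n = n} f g = trans (sum-cong-≗ (λ i → ∑-distrib-+ (f i) (g i))) (∑-distrib-+ (λ i → ∑[ j < n ] f i j) (λ i → ∑[ j < n ] g i j))

2xy≤x²+y² : ∀ x y → 2 * (x * y) ≤ x * x + y * y
2xy≤x²+y² x y = [ ordered , swapped ]′ (≤-total x y)
  where
  ordered : ∀ {x y} → x ≤ y → 2 * (x * y) ≤ x * x + y * y
  ordered {x} x≤y with d , refl ← m≤n⇒∃[o]m+o≡n x≤y =
    subst (2 * (x * (x + d)) ≤_) (expand x d) (m≤m+n _ (d * d))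
    where
    expand : ∀ x d → 2 * (x * (x + d)) + d * d ≡ x * x + (x + d) * (x + d)
    expand = solve-∀
  swapped : y ≤ x → 2 * (x * y) ≤ x * x + y * y
  swapped y≤x = subst₂ _≤_ (cong (2 *_) (*-comm y x)) (+-comm (y * y) (x * x)) (ordered y≤x)

cauchy-schwarz : ∀ {n} (c : Fin n → ℕ) → sum c * sum c ≤ n * ∑[ i < n ] (c i * c i)
cauchy-schwarz {n} c = *-cancelˡ-≤ 2 (begin
  2 * (sum c * sum c)                               ≡⟨ cong (2 *_) (∑-*-∑ c c) ⟩
  2 * ∑[ i < n ] ∑[ j < n ] (c i * c j)             ≡⟨ *-distribˡ-sum 2 (λ i → ∑[ j < n ] (c i * c j)) ⟩
  ∑[ i < n ] (2 * ∑[ j < n ] (c i * c j))           ≡⟨ sum-cong-≗ (λ i → *-distribˡ-sum 2 (λ j → c i * c j)) ⟩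
  ∑[ i < n ] ∑[ j < n ] (2 * (c i * c j))           ≤⟨ ∑-mono-≤ (λ i → ∑-mono-≤ (λ j → 2xy≤x²+y² (c i) (c j))) ⟩
  ∑[ i < n ] ∑[ j < n ] (c² i + c² j)               ≡⟨ ∑∑-distrib-+ (λ i _ → c² i) (λ _ j → c² j) ⟩
  ∑[ i < n ] ∑[ j < n ] c² i + ∑[ i < n ] Q         ≡⟨ cong₂ _+_ (trans (sum-cong-≗ (λ i → ∑-const n (c² i))) (sym (*-distribˡ-sum n c²))) (∑-const n Q) ⟩
  n * Q + n * Q                                     ≡⟨ cong (n * Q +_) (sym (+-identityʳ (n * Q))) ⟩
  2 * (n * Q)                                       ∎)
  where
  open ≤-Reasoning
  c² : Fin n → ℕ
  c² i = c i * c i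
  Q : ℕ
  Q = sum c²

⟦_⟧ : Bool → ℕ
⟦ true  ⟧ = 1
⟦ false ⟧ = 0

⟦x∧y⟧≡⟦x⟧*⟦y⟧ : ∀ x y → ⟦ x ∧ y ⟧ ≡ ⟦ x ⟧ * ⟦ y ⟧
⟦x∧y⟧≡⟦x⟧*⟦y⟧ true  y = sym (+-identityʳ ⟦ y ⟧)
⟦x∧y⟧≡⟦x⟧*⟦y⟧ false y = refl

⟦x∧y⟧≤⟦y⟧ : ∀ x y → ⟦ x ∧ y ⟧ ≤ ⟦ y ⟧
⟦x∧y⟧≤⟦y⟧ true  y = ≤-refl
⟦x∧y⟧≤⟦y⟧ false y = z≤n

⟦x∨y⟧≤⟦x⟧+⟦y⟧ : ∀ x y → ⟦ x ∨ y ⟧ ≤ ⟦ x ⟧ + ⟦ y ⟧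
⟦x∨y⟧≤⟦x⟧+⟦y⟧ true  y = s≤s z≤n
⟦x∨y⟧≤⟦x⟧+⟦y⟧ false y = ≤-refl

⟦x⟧≤1 : ∀ x → ⟦ x ⟧ ≤ 1
⟦x⟧≤1 true  = ≤-refl
⟦x⟧≤1 false = z≤n

⟦x⟧+⟦¬x⟧≡1 : ∀ x → ⟦ x ⟧ + ⟦ not x ⟧ ≡ 1
⟦x⟧+⟦¬x⟧≡1 true  = refl
⟦x⟧+⟦¬x⟧≡1 false = refl

⟦x⟧*n≤n : ∀ x n → ⟦ x ⟧ * n ≤ n
⟦x⟧*n≤n x n = ≤-trans (*-monoˡ-≤ n (⟦x⟧≤1 x)) (≤-reflexive (*-identityˡ n))

⟦x⟧*-monoʳ-≤ : ∀ x {m n} → (T x → m ≤ n) → ⟦ x ⟧ * m ≤ ⟦ x ⟧ * n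
⟦x⟧*-monoʳ-≤ true  m≤n = *-monoʳ-≤ 1 (m≤n _)
⟦x⟧*-monoʳ-≤ false m≤n = z≤n

⟦m<ᵇn⟧+⟦n<ᵇm⟧≡1 : ∀ m n → m ≢ n → ⟦ m <ᵇ n ⟧ + ⟦ n <ᵇ m ⟧ ≡ 1
⟦m<ᵇn⟧+⟦n<ᵇm⟧≡1 zero    zero    m≢n = ⊥-elim (m≢n refl)
⟦m<ᵇn⟧+⟦n<ᵇm⟧≡1 zero    (suc n) m≢n = refl
⟦m<ᵇn⟧+⟦n<ᵇm⟧≡1 (suc m) zero    m≢n = refl
⟦m<ᵇn⟧+⟦n<ᵇm⟧≡1 (suc m) (suc n) m≢n = ⟦m<ᵇn⟧+⟦n<ᵇm⟧≡1 m n (m≢n ∘ cong suc)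

δ : ∀ {n} → Fin n → Fin n → ℕ
δ a i = ⟦ ⌊ a ≟ i ⌋ ⟧

δ-suc : ∀ {n} (a i : Fin n) → δ (Fin.suc a) (Fin.suc i) ≡ δ a i
δ-suc a i with a ≟ i
... | yes _ = refl
... | no  _ = refl

δ-sym : ∀ {n} (a i : Fin n) → δ a i ≡ δ i a
δ-sym a i with a ≟ i | i ≟ a
... | yes _   | yes _   = refl
... | no  _   | no  _   = refl
... | yes a≡i | no  i≢a = ⊥-elim (i≢a (sym a≡i))
... | no  a≢i | yes i≡a = ⊥-elim (a≢i (sym i≡a))

∑-δ : ∀ {n} (a : Fin n) (g : Fin n → ℕ) → ∑[ i < n ] (g i * δ a i) ≡ g a
∑-δ {suc n} Fin.zero g = begin
  g Fin.zero * 1 + ∑[ i < n ] (g (Fin.suc i) * 0) ≡⟨ cong₂ _+_ (*-identityʳ _) (sum-cong-≗ (λ i → *-zeroʳ (g (Fin.suc i)))) ⟩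
  g Fin.zero + ∑[ i < n ] 0                       ≡⟨ cong (g Fin.zero +_) (sum-replicate-zero n) ⟩
  g Fin.zero + 0                                  ≡⟨ +-identityʳ _ ⟩
  g Fin.zero                                      ∎
  where open ≡-Reasoning
∑-δ {suc n} (Fin.suc a) g = begin
  g Fin.zero * 0 + ∑[ i < n ] (g (Fin.suc i) * δ (Fin.suc a) (Fin.suc i)) ≡⟨ cong₂ _+_ (*-zeroʳ (g Fin.zero)) (sum-cong-≗ (λ i → cong (g (Fin.suc i) *_) (δ-suc a i))) ⟩
  ∑[ i < n ] (g (Fin.suc i) * δ a i)                                       ≡⟨ ∑-δ a (g ∘ Fin.suc) ⟩
  g (Fin.suc a)                                                            ∎
  where open ≡-Reasoning

∑-δ′ : ∀ {n} (a : Fin n) (g : Fin n → ℕ) → ∑[ i < n ] (g i * δ i a) ≡ g a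
∑-δ′ a g = trans (sum-cong-≗ (λ i → cong (g i *_) (δ-sym i a))) (∑-δ a g)

∑-δ≡1 : ∀ {n} (a : Fin n) → ∑[ i < n ] δ a i ≡ 1
∑-δ≡1 a = trans (sum-cong-≗ (λ i → sym (*-identityˡ (δ a i)))) (∑-δ a (λ _ → 1))

∣p∣≡∑ : ∀ {n} (p : Subset n) → ∣ p ∣ ≡ ∑[ i < n ] ⟦ Vec.lookup p i ⟧
∣p∣≡∑ Vec.[]           = refl
∣p∣≡∑ (true  Vec.∷ p) = cong suc (∣p∣≡∑ p)
∣p∣≡∑ (false Vec.∷ p) = ∣p∣≡∑ p

deg≡∑ : ∀ {n} (G : Graph n) i → deg G i ≡ ∑[ j < n ] ⟦ G i j ⟧
deg≡∑ G i = trans (∣p∣≡∑ (nbhd G i)) (sum-cong-≗ (cong ⟦_⟧ ∘ lookup∘tabulate (G i)))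

∣nbhd∩p∣≡∑ : ∀ {n} (G : Graph n) i (p : Subset n) → ∣ nbhd G i ∩ p ∣ ≡ ∑[ j < n ] ⟦ G i j ∧ Vec.lookup p j ⟧
∣nbhd∩p∣≡∑ G i p = trans (∣p∣≡∑ (nbhd G i ∩ p)) (sum-cong-≗ λ j → cong ⟦_⟧
  (trans (lookup-zipWith _∧_ j (nbhd G i) p) (cong (_∧ Vec.lookup p j) (lookup∘tabulate (G i) j))))

module _ {A : Set} where

  ∑-lookup : ∀ (xs : List A) (h : A → ℕ) → ∑[ e < length xs ] h (List.lookup xs e) ≡ ℕList.sum (map h xs)
  ∑-lookup []       h = refl
  ∑-lookup (x ∷ xs) h = cong (h x +_) (∑-lookup xs h)

  sum-map-filterᵇ : ∀ (p : A → Bool) (xs : List A) (h : A → ℕ) →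
                    ℕList.sum (map h (filterᵇ p xs)) ≡ ℕList.sum (map (λ x → ⟦ p x ⟧ * h x) xs)
  sum-map-filterᵇ p []       h = refl
  sum-map-filterᵇ p (x ∷ xs) h with p x
  ... | true  = cong₂ _+_ (sym (+-identityʳ (h x))) (sum-map-filterᵇ p xs h)
  ... | false = sum-map-filterᵇ p xs h

  sum-map-tabulate : ∀ {n} (f : Fin n → A) (h : A → ℕ) → ℕList.sum (map h (List.tabulate f)) ≡ ∑[ i < n ] h (f i)
  sum-map-tabulate {zero}  f h = refl
  sum-map-tabulate {suc n} f h = cong (h (f Fin.zero) +_) (sum-map-tabulate (f ∘ Fin.suc) h)

  sum-map-concatMap : ∀ {B : Set} (f : B → List A) (xs : List B) (h : A → ℕ) →
                      ℕList.sum (map h (concatMap f xs)) ≡ ℕList.sum (map (ℕList.sum ∘ map h ∘ f) xs)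
  sum-map-concatMap f []       h = refl
  sum-map-concatMap f (x ∷ xs) h = begin
    ℕList.sum (map h (f x List.++ concatMap f xs))                 ≡⟨ cong ℕList.sum (map-++ h (f x) (concatMap f xs)) ⟩
    ℕList.sum (map h (f x) List.++ map h (concatMap f xs))         ≡⟨ sum-++ (map h (f x)) _ ⟩
    ℕList.sum (map h (f x)) + ℕList.sum (map h (concatMap f xs))   ≡⟨ cong (ℕList.sum (map h (f x)) +_) (sum-map-concatMap f xs h) ⟩
    ℕList.sum (map h (f x)) + ℕList.sum (map (ℕList.sum ∘ map h ∘ f) xs) ∎
    where open ≡-Reasoning

sum-map-allPairs : ∀ n (h : Fin n × Fin n → ℕ) → ℕList.sum (map h (allPairs n)) ≡ ∑[ i < n ] ∑[ j < n ] h (i , j)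
sum-map-allPairs n h = begin
  ℕList.sum (map h (concatMap row (allFin n)))           ≡⟨ sum-map-concatMap row (allFin n) h ⟩
  ℕList.sum (map (ℕList.sum ∘ map h ∘ row) (allFin n))  ≡⟨ sum-map-tabulate (λ i → i) (ℕList.sum ∘ map h ∘ row) ⟩
  ∑[ i < n ] ℕList.sum (map h (row i))                   ≡⟨ sum-cong-≗ (λ i → cong ℕList.sum (sym (map-∘ {g = h} {f = i ,_} (allFin n)))) ⟩
  ∑[ i < n ] ℕList.sum (map (h ∘ (i ,_)) (allFin n))     ≡⟨ sum-cong-≗ (λ i → sum-map-tabulate (λ j → j) (h ∘ (i ,_))) ⟩
  ∑[ i < n ] ∑[ j < n ] h (i , j)                        ∎
  where
  row : Fin n → List (Fin n × Fin n)
  row i = map (i ,_) (allFin n)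
  open ≡-Reasoning

incidence : ∀ {n} → Fin n → Fin n × Fin n → ℕ
incidence x (a , b) = δ x a + δ x b

∑-*-incidence : ∀ {n} (f : Fin n → ℕ) (q : Fin n × Fin n) → ∑[ x < n ] (f x * incidence x q) ≡ f (proj₁ q) + f (proj₂ q)
∑-*-incidence f (a , b) = begin
  ∑[ x < _ ] (f x * (δ x a + δ x b))                ≡⟨ sum-cong-≗ (λ x → *-distribˡ-+ (f x) (δ x a) (δ x b)) ⟩
  ∑[ x < _ ] (f x * δ x a + f x * δ x b)            ≡⟨ ∑-distrib-+ (λ x → f x * δ x a) (λ x → f x * δ x b) ⟩
  ∑[ x < _ ] (f x * δ x a) + ∑[ x < _ ] (f x * δ x b) ≡⟨ cong₂ _+_ (∑-δ′ a f) (∑-δ′ b f) ⟩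
  f a + f b                                          ∎
  where open ≡-Reasoning

⟦shareEnd⟧≤incidence : ∀ {n} (a b : Fin n) q → ⟦ shareEnd (a , b) q ⟧ ≤ incidence a q + incidence b q
⟦shareEnd⟧≤incidence a b (c , d) = begin
  ⟦ ⌊ a ≟ c ⌋ ∨ ⌊ a ≟ d ⌋ ∨ ⌊ b ≟ c ⌋ ∨ ⌊ b ≟ d ⌋ ⟧ ≤⟨ ⟦x∨y⟧≤⟦x⟧+⟦y⟧ ⌊ a ≟ c ⌋ _ ⟩
  δ a c + ⟦ ⌊ a ≟ d ⌋ ∨ ⌊ b ≟ c ⌋ ∨ ⌊ b ≟ d ⌋ ⟧       ≤⟨ +-monoʳ-≤ (δ a c) (⟦x∨y⟧≤⟦x⟧+⟦y⟧ ⌊ a ≟ d ⌋ _) ⟩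
  δ a c + (δ a d + ⟦ ⌊ b ≟ c ⌋ ∨ ⌊ b ≟ d ⌋ ⟧)         ≤⟨ +-monoʳ-≤ (δ a c) (+-monoʳ-≤ (δ a d) (⟦x∨y⟧≤⟦x⟧+⟦y⟧ ⌊ b ≟ c ⌋ _)) ⟩
  δ a c + (δ a d + (δ b c + δ b d))                   ≡⟨ +-assoc (δ a c) (δ a d) _ ⟨
  (δ a c + δ a d) + (δ b c + δ b d)                   ∎
  where open ≤-Reasoning

-- The last term accounts for (c , d) = (a , b), the only way for both a and b to meet (c , d).
incidence-≤-shareEnd : ∀ {n} {a b c d : Fin n} → toℕ a < toℕ b → toℕ c < toℕ d →
                       incidence a (c , d) + incidence b (c , d) ≤ ⟦ shareEnd (a , b) (c , d) ⟧ + δ a c * δ b d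
incidence-≤-shareEnd {a = a} {b} {c} {d} a<b c<d with a ≟ c | a ≟ d | b ≟ c | b ≟ d
... | yes refl | yes refl | _        | _        = ⊥-elim (<-irrefl refl c<d)
... | _        | _        | yes refl | yes refl = ⊥-elim (<-irrefl refl c<d)
... | yes refl | _        | yes refl | _        = ⊥-elim (<-irrefl refl a<b)
... | _        | yes refl | _        | yes refl = ⊥-elim (<-irrefl refl a<b)
... | _        | yes refl | yes refl | _        = ⊥-elim (<-asym a<b c<d)
... | yes _    | no _     | no _     | yes _    = ≤-refl
... | yes _    | no _     | no _     | no _     = ≤-refl
... | no _     | yes _    | no _     | no _     = ≤-refl
... | no _     | no _     | yes _    | no _     = ≤-refl
... | no _     | no _     | no _     | yes _    = ≤-refl
... | no _     | no _     | no _     | no _     = ≤-refl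

module _ {n} (G : Graph n) where

  listed : Fin n → Fin n → Bool
  listed i j = (toℕ i <ᵇ toℕ j) ∧ G i j

  listed⇒< : ∀ {i j} → T (listed i j) → toℕ i < toℕ j
  listed⇒< {i} {j} t = <ᵇ⇒< (toℕ i) (toℕ j) (proj₁ (Equivalence.to T-∧ t))

  ∑-edges : ∀ (h : Fin n × Fin n → ℕ) →
            ∑[ e < numEdges G ] h (edge G e) ≡ ∑[ i < n ] ∑[ j < n ] (⟦ listed i j ⟧ * h (i , j))
  ∑-edges h = begin
    ∑[ e < numEdges G ] h (edge G e)                   ≡⟨ ∑-lookup (edgeList G) h ⟩
    ℕList.sum (map h (edgeList G))                      ≡⟨ sum-map-filterᵇ _ (allPairs n) h ⟩
    ℕList.sum (map (λ q → ⟦ listed (proj₁ q) (proj₂ q) ⟧ * h q) (allPairs n)) ≡⟨ sum-map-allPairs n _ ⟩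
    ∑[ i < n ] ∑[ j < n ] (⟦ listed i j ⟧ * h (i , j)) ∎
    where open ≡-Reasoning

  edge-ordered : ∀ e → toℕ (proj₁ (edge G e)) < toℕ (proj₂ (edge G e))
  edge-ordered e = listed⇒< (proj₂ (∈-filter⁻ listed? {xs = allPairs n} (∈-lookup {xs = edgeList G} e)))
    where
    listed? : ∀ q → Dec (T (listed (proj₁ q) (proj₂ q)))
    listed? q = T? (listed (proj₁ q) (proj₂ q))

  degIn : Subset (numEdges G) → Fin n → ℕ
  degIn p x = ∑[ e < numEdges G ] (⟦ Vec.lookup p e ⟧ * incidence x (edge G e))

  ∑-*-degIn : ∀ p (f : Fin n → ℕ) →
              ∑[ x < n ] (f x * degIn p x) ≡ ∑[ e < numEdges G ] (⟦ Vec.lookup p e ⟧ * (f (proj₁ (edge G e)) + f (proj₂ (edge G e))))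
  ∑-*-degIn p f = begin
    ∑[ x < n ] (f x * degIn p x)                                    ≡⟨ sum-cong-≗ (λ x → *-distribˡ-sum (f x) (λ e → w e * incidence x (edge G e))) ⟩
    ∑[ x < n ] ∑[ e < m ] (f x * (w e * incidence x (edge G e)))    ≡⟨ ∑-comm (λ x e → f x * (w e * incidence x (edge G e))) ⟩
    ∑[ e < m ] ∑[ x < n ] (f x * (w e * incidence x (edge G e)))    ≡⟨ sum-cong-≗ (λ e → sum-cong-≗ (λ x → x∙yz≈y∙xz (f x) (w e) (incidence x (edge G e)))) ⟩
    ∑[ e < m ] ∑[ x < n ] (w e * (f x * incidence x (edge G e)))    ≡⟨ sum-cong-≗ (λ e → *-distribˡ-sum (w e) (λ x → f x * incidence x (edge G e))) ⟨
    ∑[ e < m ] (w e * ∑[ x < n ] (f x * incidence x (edge G e)))    ≡⟨ sum-cong-≗ (λ e → cong (w e *_) (∑-*-incidence f (edge G e))) ⟩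
    ∑[ e < m ] (w e * (f (proj₁ (edge G e)) + f (proj₂ (edge G e)))) ∎
    where
    open ≡-Reasoning
    m : ℕ
    m = numEdges G
    w : Fin m → ℕ
    w e = ⟦ Vec.lookup p e ⟧

  ∑-degIn : ∀ p → ∑[ x < n ] degIn p x ≡ 2 * ∣ p ∣
  ∑-degIn p = begin
    ∑[ x < n ] degIn p x                                       ≡⟨ sum-cong-≗ (λ x → *-identityˡ (degIn p x)) ⟨
    ∑[ x < n ] (1 * degIn p x)                                 ≡⟨ ∑-*-degIn p (λ _ → 1) ⟩
    ∑[ e < numEdges G ] (⟦ Vec.lookup p e ⟧ * 2)               ≡⟨ *-distribʳ-sum 2 (λ e → ⟦ Vec.lookup p e ⟧) ⟨
    ∑[ e < numEdges G ] ⟦ Vec.lookup p e ⟧ * 2                 ≡⟨ cong (_* 2) (∣p∣≡∑ p) ⟨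
    ∣ p ∣ * 2                                                  ≡⟨ *-comm ∣ p ∣ 2 ⟩
    2 * ∣ p ∣                                                  ∎
    where open ≡-Reasoning

  ∑shareEnd≤deg-LineGraph+1 : ∀ e → ∑[ f < numEdges G ] ⟦ shareEnd (edge G e) (edge G f) ⟧ ≤ deg (LineGraph G) e + 1
  ∑shareEnd≤deg-LineGraph+1 e = begin
    ∑[ f < numEdges G ] ⟦ shareEnd (edge G e) (edge G f) ⟧                   ≤⟨ ∑-mono-≤ shareEnd≤adjacent+δ ⟩
    ∑[ f < numEdges G ] (⟦ LineGraph G e f ⟧ + δ e f)                        ≡⟨ ∑-distrib-+ (λ f → ⟦ LineGraph G e f ⟧) (δ e) ⟩
    ∑[ f < numEdges G ] ⟦ LineGraph G e f ⟧ + ∑[ f < numEdges G ] δ e f      ≡⟨ cong₂ _+_ (sym (deg≡∑ (LineGraph G) e)) (∑-δ≡1 e) ⟩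
    deg (LineGraph G) e + 1                                                  ∎
    where
    open ≤-Reasoning
    shareEnd≤adjacent+δ : ∀ f → ⟦ shareEnd (edge G e) (edge G f) ⟧ ≤ ⟦ LineGraph G e f ⟧ + δ e f
    shareEnd≤adjacent+δ f with e ≟ f
    ... | yes _ = ⟦x⟧≤1 _
    ... | no  _ = m≤m+n _ 0

  ∣nbhd-LineGraph∩p∣≤degIn+degIn : ∀ e p →
    ∣ nbhd (LineGraph G) e ∩ p ∣ ≤ degIn p (proj₁ (edge G e)) + degIn p (proj₂ (edge G e))
  ∣nbhd-LineGraph∩p∣≤degIn+degIn e p = begin
    ∣ nbhd (LineGraph G) e ∩ p ∣                                ≡⟨ ∣nbhd∩p∣≡∑ (LineGraph G) e p ⟩
    ∑[ f < numEdges G ] ⟦ LineGraph G e f ∧ Vec.lookup p f ⟧    ≤⟨ ∑-mono-≤ adjacent≤incidences ⟩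
    ∑[ f < numEdges G ] (w f * inc a f + w f * inc b f)         ≡⟨ ∑-distrib-+ (λ f → w f * inc a f) (λ f → w f * inc b f) ⟩
    degIn p a + degIn p b                                       ∎
    where
    open ≤-Reasoning
    a b : Fin n
    a = proj₁ (edge G e)
    b = proj₂ (edge G e)
    w : Fin (numEdges G) → ℕ
    w f = ⟦ Vec.lookup p f ⟧
    inc : Fin n → Fin (numEdges G) → ℕ
    inc x f = incidence x (edge G f)
    adjacent≤incidences : ∀ f → ⟦ LineGraph G e f ∧ Vec.lookup p f ⟧ ≤ w f * inc a f + w f * inc b f
    adjacent≤incidences f = begin
      ⟦ LineGraph G e f ∧ Vec.lookup p f ⟧   ≡⟨ ⟦x∧y⟧≡⟦x⟧*⟦y⟧ (LineGraph G e f) (Vec.lookup p f) ⟩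
      ⟦ LineGraph G e f ⟧ * w f              ≤⟨ *-monoˡ-≤ (w f) (≤-trans (⟦x∧y⟧≤⟦y⟧ (not ⌊ e ≟ f ⌋) _) (⟦shareEnd⟧≤incidence a b (edge G f))) ⟩
      (inc a f + inc b f) * w f              ≡⟨ *-comm (inc a f + inc b f) (w f) ⟩
      w f * (inc a f + inc b f)              ≡⟨ *-distribˡ-+ (w f) (inc a f) (inc b f) ⟩
      w f * inc a f + w f * inc b f          ∎

module _ {n} (G : Graph n) (simple : IsSimple G) where

  open IsSimple simple renaming (sym to G-sym; irrefl to G-irrefl)

  ⟦listed⟧+⟦listed⟧≡⟦G⟧ : ∀ i j → ⟦ listed G i j ⟧ + ⟦ listed G j i ⟧ ≡ ⟦ G i j ⟧
  ⟦listed⟧+⟦listed⟧≡⟦G⟧ i j = begin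
    ⟦ i<j ∧ G i j ⟧ + ⟦ j<i ∧ G j i ⟧      ≡⟨ cong (λ g → ⟦ i<j ∧ G i j ⟧ + ⟦ j<i ∧ g ⟧) (G-sym j i) ⟩
    ⟦ i<j ∧ G i j ⟧ + ⟦ j<i ∧ G i j ⟧      ≡⟨ cong₂ _+_ (⟦x∧y⟧≡⟦x⟧*⟦y⟧ i<j (G i j)) (⟦x∧y⟧≡⟦x⟧*⟦y⟧ j<i (G i j)) ⟩
    ⟦ i<j ⟧ * ⟦ G i j ⟧ + ⟦ j<i ⟧ * ⟦ G i j ⟧ ≡⟨ *-distribʳ-+ ⟦ G i j ⟧ ⟦ i<j ⟧ ⟦ j<i ⟧ ⟨
    (⟦ i<j ⟧ + ⟦ j<i ⟧) * ⟦ G i j ⟧         ≡⟨ exactly-one-order ⟩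
    ⟦ G i j ⟧                              ∎
    where
    open ≡-Reasoning
    i<j j<i : Bool
    i<j = toℕ i <ᵇ toℕ j
    j<i = toℕ j <ᵇ toℕ i
    exactly-one-order : (⟦ i<j ⟧ + ⟦ j<i ⟧) * ⟦ G i j ⟧ ≡ ⟦ G i j ⟧
    exactly-one-order with i ≟ j
    ... | yes refl rewrite G-irrefl i = *-zeroʳ (⟦ i<j ⟧ + ⟦ j<i ⟧)
    ... | no  i≢j = trans (cong (_* ⟦ G i j ⟧) (⟦m<ᵇn⟧+⟦n<ᵇm⟧≡1 (toℕ i) (toℕ j) (i≢j ∘ toℕ-injective))) (*-identityˡ ⟦ G i j ⟧)

  ∑-incidence≡deg : ∀ x → ∑[ e < numEdges G ] incidence x (edge G e) ≡ deg G x
  ∑-incidence≡deg x = begin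
    ∑[ e < numEdges G ] incidence x (edge G e)                          ≡⟨ ∑-edges G (incidence x) ⟩
    ∑[ i < n ] ∑[ j < n ] (L i j * (δ x i + δ x j))                     ≡⟨ sum-cong-≗ (λ i → sum-cong-≗ λ j → *-distribˡ-+ (L i j) (δ x i) (δ x j)) ⟩
    ∑[ i < n ] ∑[ j < n ] (L i j * δ x i + L i j * δ x j)               ≡⟨ ∑∑-distrib-+ (λ i j → L i j * δ x i) (λ i j → L i j * δ x j) ⟩
    ∑[ i < n ] ∑[ j < n ] (L i j * δ x i) + ∑[ i < n ] ∑[ j < n ] (L i j * δ x j)
                                                                        ≡⟨ cong (∑[ i < n ] ∑[ j < n ] (L i j * δ x i) +_) (∑-comm (λ i j → L i j * δ x j)) ⟩
    ∑[ i < n ] ∑[ j < n ] (L i j * δ x i) + ∑[ i < n ] ∑[ j < n ] (L j i * δ x i)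
                                                                        ≡⟨ ∑∑-distrib-+ (λ i j → L i j * δ x i) (λ i j → L j i * δ x i) ⟨
    ∑[ i < n ] ∑[ j < n ] (L i j * δ x i + L j i * δ x i)               ≡⟨ sum-cong-≗ (λ i → sum-cong-≗ λ j → trans (cong (_* δ x i) (sym (⟦listed⟧+⟦listed⟧≡⟦G⟧ i j))) (*-distribʳ-+ (δ x i) (L i j) (L j i))) ⟨
    ∑[ i < n ] ∑[ j < n ] (⟦ G i j ⟧ * δ x i)                           ≡⟨ sum-cong-≗ (λ i → trans (cong (_* δ x i) (deg≡∑ G i)) (*-distribʳ-sum (δ x i) (λ j → ⟦ G i j ⟧))) ⟨
    ∑[ i < n ] (deg G i * δ x i)                                        ≡⟨ ∑-δ x (deg G) ⟩
    deg G x                                                             ∎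
    where
    open ≡-Reasoning
    L : Fin n → Fin n → ℕ
    L i j = ⟦ listed G i j ⟧

  degIn+degIn∁≡deg : ∀ p x → degIn G p x + degIn G (∁ p) x ≡ deg G x
  degIn+degIn∁≡deg p x = begin
    degIn G p x + degIn G (∁ p) x                                    ≡⟨ ∑-distrib-+ (λ e → w e * inc e) (λ e → w∁ e * inc e) ⟨
    ∑[ e < numEdges G ] (w e * inc e + w∁ e * inc e)                 ≡⟨ sum-cong-≗ (λ e → *-distribʳ-+ (inc e) (w e) (w∁ e)) ⟨
    ∑[ e < numEdges G ] ((w e + w∁ e) * inc e)                       ≡⟨ sum-cong-≗ (λ e → trans (cong (λ y → (w e + ⟦ y ⟧) * inc e) (lookup-map e not p)) (cong (_* inc e) (⟦x⟧+⟦¬x⟧≡1 (Vec.lookup p e)))) ⟩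
    ∑[ e < numEdges G ] (1 * inc e)                                  ≡⟨ sum-cong-≗ (λ e → *-identityˡ (inc e)) ⟩
    ∑[ e < numEdges G ] inc e                                        ≡⟨ ∑-incidence≡deg x ⟩
    deg G x                                                          ∎
    where
    open ≡-Reasoning
    w w∁ inc : Fin (numEdges G) → ℕ
    w e = ⟦ Vec.lookup p e ⟧
    w∁ e = ⟦ Vec.lookup (∁ p) e ⟧
    inc e = incidence x (edge G e)

  -- Summing over all vertex pairs instead of the edge list spares a proof that the edge list
  -- has no repetitions: the pair (a , b) of e occurs exactly once.
  deg+deg≤deg-LineGraph+2 : ∀ e → deg G (proj₁ (edge G e)) + deg G (proj₂ (edge G e)) ≤ deg (LineGraph G) e + 2
  deg+deg≤deg-LineGraph+2 e = begin
    deg G a + deg G b                                                       ≡⟨ cong₂ _+_ (∑-incidence≡deg a) (∑-incidence≡deg b) ⟨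
    ∑[ f < m ] incidence a (edge G f) + ∑[ f < m ] incidence b (edge G f)   ≡⟨ ∑-distrib-+ (λ f → incidence a (edge G f)) (λ f → incidence b (edge G f)) ⟨
    ∑[ f < m ] (incidence a (edge G f) + incidence b (edge G f))            ≡⟨ ∑-edges G (λ q → incidence a q + incidence b q) ⟩
    ∑[ i < n ] ∑[ j < n ] (L i j * (incidence a (i , j) + incidence b (i , j)))
                                                                            ≤⟨ ∑-mono-≤ (λ i → ∑-mono-≤ (pointwise i)) ⟩
    ∑[ i < n ] ∑[ j < n ] (L i j * S (i , j) + δ a i * δ b j)               ≡⟨ ∑∑-distrib-+ (λ i j → L i j * S (i , j)) (λ i j → δ a i * δ b j) ⟩
    ∑[ i < n ] ∑[ j < n ] (L i j * S (i , j)) + ∑[ i < n ] ∑[ j < n ] (δ a i * δ b j)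
                                                                            ≡⟨ cong₂ _+_ (sym (∑-edges G S)) (trans (sym (∑-*-∑ (δ a) (δ b))) (cong₂ _*_ (∑-δ≡1 a) (∑-δ≡1 b))) ⟩
    ∑[ f < m ] S (edge G f) + 1                                             ≤⟨ +-monoˡ-≤ 1 (∑shareEnd≤deg-LineGraph+1 G e) ⟩
    deg (LineGraph G) e + 1 + 1                                             ≡⟨ +-assoc (deg (LineGraph G) e) 1 1 ⟩
    deg (LineGraph G) e + 2                                                 ∎
    where
    open ≤-Reasoning
    m : ℕ
    m = numEdges G
    a b : Fin n
    a = proj₁ (edge G e)
    b = proj₂ (edge G e)
    L : Fin n → Fin n → ℕ
    L i j = ⟦ listed G i j ⟧
    S : Fin n × Fin n → ℕ
    S q = ⟦ shareEnd (a , b) q ⟧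
    pointwise : ∀ i j → L i j * (incidence a (i , j) + incidence b (i , j)) ≤ L i j * S (i , j) + δ a i * δ b j
    pointwise i j = begin
      L i j * (incidence a (i , j) + incidence b (i , j))   ≤⟨ ⟦x⟧*-monoʳ-≤ (listed G i j) (incidence-≤-shareEnd (edge-ordered G e) ∘ listed⇒< G) ⟩
      L i j * (S (i , j) + δ a i * δ b j)                   ≡⟨ *-distribˡ-+ (L i j) (S (i , j)) (δ a i * δ b j) ⟩
      L i j * S (i , j) + L i j * (δ a i * δ b j)           ≤⟨ +-monoʳ-≤ (L i j * S (i , j)) (⟦x⟧*n≤n (listed G i j) (δ a i * δ b j)) ⟩
      L i j * S (i , j) + δ a i * δ b j                     ∎

cu+cv≤k+1 : ∀ {k mu cu mv cv} → mu + cu ≡ k → mv + cv ≡ k → k + k ≤ 2 * (mu + mv) + 2 → cu + cv ≤ k + 1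
cu+cv≤k+1 {k} {mu} {cu} {mv} {cv} mu+cu≡k mv+cv≡k k+k≤ = +-cancelʳ-≤ (mu + mv) (cu + cv) (k + 1) (begin
  (cu + cv) + (mu + mv)  ≡⟨ regroup mu cu mv cv ⟩
  (mu + cu) + (mv + cv)  ≡⟨ cong₂ _+_ mu+cu≡k mv+cv≡k ⟩
  k + k                  ≤⟨ +-monoʳ-≤ k k≤s+1 ⟩
  k + ((mu + mv) + 1)    ≡⟨ shift k (mu + mv) ⟩
  (k + 1) + (mu + mv)    ∎)
  where
  open ≤-Reasoning
  regroup : ∀ mu cu mv cv → (cu + cv) + (mu + mv) ≡ (mu + cu) + (mv + cv)
  regroup = solve-∀
  shift : ∀ k s → k + (s + 1) ≡ (k + 1) + s
  shift = solve-∀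
  double : ∀ k → k + k ≡ 2 * k
  double = solve-∀
  double′ : ∀ s → 2 * s + 2 ≡ 2 * (s + 1)
  double′ = solve-∀
  k≤s+1 : k ≤ (mu + mv) + 1
  k≤s+1 = *-cancelˡ-≤ 2 (subst₂ _≤_ (double k) (double′ (mu + mv)) k+k≤)

4h≤n[k+1] : ∀ n k h → (2 * h) * (2 * h) ≤ n * (h * (k + 1)) → 4 * h ≤ n * (k + 1)
4h≤n[k+1] n k zero    _  = z≤n
4h≤n[k+1] n k (suc h) sq = *-cancelˡ-≤ (suc h) (subst₂ _≤_ (square (suc h)) (swap (suc h) n (k + 1)) sq)
  where
  square : ∀ h → (2 * h) * (2 * h) ≡ h * (4 * h)
  square = solve-∀
  swap : ∀ h n x → n * (h * x) ≡ h * (n * x)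
  swap = solve-∀

n[k∸1]≤4p : ∀ n k p h → 2 * p + 2 * h ≡ n * k → 4 * h ≤ n * (k + 1) → n * (k ∸ 1) ≤ 4 * p
n[k∸1]≤4p n zero    p h _       _     = ≤-trans (≤-reflexive (*-zeroʳ n)) z≤n
n[k∸1]≤4p n (suc k) p h 2p+2h≡nk 4h≤ = +-cancelʳ-≤ (4 * h) (n * k) (4 * p) (begin
  n * k + 4 * h                ≤⟨ +-monoʳ-≤ (n * k) 4h≤ ⟩
  n * k + n * (suc k + 1)      ≡⟨ expand n k ⟩
  2 * (n * suc k)              ≡⟨ cong (2 *_) 2p+2h≡nk ⟨
  2 * (2 * p + 2 * h)          ≡⟨ double p h ⟩
  4 * p + 4 * h                ∎)
  where
  open ≤-Reasoning
  expand : ∀ n k → n * k + n * (suc k + 1) ≡ 2 * (n * suc k)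
  expand = solve-∀
  double : ∀ p h → 2 * (2 * p + 2 * h) ≡ 4 * p + 4 * h
  double = solve-∀

module MonopolyCounting {n} (k : ℕ) (G : Graph n) (simple : IsSimple G) (regular : Regular G k)
         (M : Subset (numEdges G)) (monopoly : IsMajorityMonopoly (LineGraph G) M) where

  degM deg∁M : Fin n → ℕ
  degM  = degIn G M
  deg∁M = degIn G (∁ M)

  degM+deg∁M≡k : ∀ x → degM x + deg∁M x ≡ k
  degM+deg∁M≡k x = trans (degIn+degIn∁≡deg G simple M x) (regular x)

  deg∁M+deg∁M≤k+1 : ∀ e → T (Vec.lookup (∁ M) e) → deg∁M (proj₁ (edge G e)) + deg∁M (proj₂ (edge G e)) ≤ k + 1
  deg∁M+deg∁M≤k+1 e e∈∁M = cu+cv≤k+1 {mu = degM a} {mv = degM b} (degM+deg∁M≡k a) (degM+deg∁M≡k b) (begin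
    k + k                                  ≡⟨ cong₂ _+_ (regular a) (regular b) ⟨
    deg G a + deg G b                      ≤⟨ deg+deg≤deg-LineGraph+2 G simple e ⟩
    deg (LineGraph G) e + 2                ≤⟨ +-monoˡ-≤ 2 (monopoly e e∉M) ⟩
    2 * ∣ nbhd (LineGraph G) e ∩ M ∣ + 2   ≤⟨ +-monoˡ-≤ 2 (*-monoʳ-≤ 2 (∣nbhd-LineGraph∩p∣≤degIn+degIn G e M)) ⟩
    2 * (degM a + degM b) + 2              ∎)
    where
    open ≤-Reasoning
    a b : Fin n
    a = proj₁ (edge G e)
    b = proj₂ (edge G e)
    e∉M : e ∉ M
    e∉M = x∈∁p⇒x∉p (lookup⇒[]= e (∁ M) (Equivalence.to T-≡ e∈∁M))

  ∑deg∁M²≤∣∁M∣*[k+1] : ∑[ x < n ] (deg∁M x * deg∁M x) ≤ ∣ ∁ M ∣ * (k + 1)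
  ∑deg∁M²≤∣∁M∣*[k+1] = begin
    ∑[ x < n ] (deg∁M x * deg∁M x)                                                    ≡⟨ ∑-*-degIn G (∁ M) deg∁M ⟩
    ∑[ e < numEdges G ] (w e * (deg∁M (proj₁ (edge G e)) + deg∁M (proj₂ (edge G e)))) ≤⟨ ∑-mono-≤ (λ e → ⟦x⟧*-monoʳ-≤ (Vec.lookup (∁ M) e) (deg∁M+deg∁M≤k+1 e)) ⟩
    ∑[ e < numEdges G ] (w e * (k + 1))                                               ≡⟨ *-distribʳ-sum (k + 1) w ⟨
    ∑[ e < numEdges G ] w e * (k + 1)                                                 ≡⟨ cong (_* (k + 1)) (∣p∣≡∑ (∁ M)) ⟨
    ∣ ∁ M ∣ * (k + 1)                                                                 ∎
    where
    open ≤-Reasoning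
    w : Fin (numEdges G) → ℕ
    w e = ⟦ Vec.lookup (∁ M) e ⟧

  2∣M∣+2∣∁M∣≡nk : 2 * ∣ M ∣ + 2 * ∣ ∁ M ∣ ≡ n * k
  2∣M∣+2∣∁M∣≡nk = begin
    2 * ∣ M ∣ + 2 * ∣ ∁ M ∣                  ≡⟨ cong₂ _+_ (∑-degIn G M) (∑-degIn G (∁ M)) ⟨
    ∑[ x < n ] degM x + ∑[ x < n ] deg∁M x   ≡⟨ ∑-distrib-+ degM deg∁M ⟨
    ∑[ x < n ] (degM x + deg∁M x)            ≡⟨ sum-cong-≗ degM+deg∁M≡k ⟩
    ∑[ x < n ] k                             ≡⟨ ∑-const n k ⟩
    n * k                                    ∎
    where open ≡-Reasoning

  4∣∁M∣≤n[k+1] : 4 * ∣ ∁ M ∣ ≤ n * (k + 1)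
  4∣∁M∣≤n[k+1] = 4h≤n[k+1] n k ∣ ∁ M ∣ (begin
    (2 * ∣ ∁ M ∣) * (2 * ∣ ∁ M ∣)        ≡⟨ cong₂ _*_ (∑-degIn G (∁ M)) (∑-degIn G (∁ M)) ⟨
    sum deg∁M * sum deg∁M                ≤⟨ cauchy-schwarz deg∁M ⟩
    n * ∑[ x < n ] (deg∁M x * deg∁M x)   ≤⟨ *-monoʳ-≤ n ∑deg∁M²≤∣∁M∣*[k+1] ⟩
    n * (∣ ∁ M ∣ * (k + 1))              ∎)
    where open ≤-Reasoning

theorem4 : (n k : ℕ) (G : Graph n) → IsSimple G → Regular G k →
           (M : Subset (numEdges G)) → IsMajorityMonopoly (LineGraph G) M →
           n * (k ∸ 1) ≤ 4 * ∣ M ∣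
theorem4 n k G simple regular M monopoly = n[k∸1]≤4p n k ∣ M ∣ ∣ ∁ M ∣ 2∣M∣+2∣∁M∣≡nk 4∣∁M∣≤n[k+1]
  where open MonopolyCounting k G simple regular M monopoly
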